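{- Let $\langle\mathsf{R},\mathsf{C}\rangle$ be a win-lose bimatrix game having a Nash equilibrium $\bm\sigma$ with $\mathsf{U}_i(\bm\sigma)=0$ for some player $i\in\{1,2\}$. Then $\langle\mathsf{R},\mathsf{C}\rangle$ has a pure Nash equilibrium.
   Context: A bimatrix game $\langle\mathsf{R},\mathsf{C}\rangle$ has two players with strategy set $[n]$ and utility matrices $\mathsf{R}$ (row player) and $\mathsf{C}$ (column player); win-lose means all entries in $\{0,1\}$. Nash equilibria are mixed, $\mathsf{U}_i(\bm\sigma)$ denotes expected utility, and a pure Nash equilibrium is a profile of pure strategies from which no player can profitably deviate.
   Formalization: The Nash equilibrium σ has rational rather than real probabilities, and the deviating mixed strategies in the equilibrium condition are likewise taken with rational probabilities. -}

module Defs where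

open import Data.Nat using (ℕ; zero; suc)
open import Data.Fin using (Fin; zero; suc)
open import Data.Rational using (ℚ; 0ℚ; 1ℚ; _+_; _*_; _≤_)
open import Data.Product using (Σ; _×_; _,_)
open import Data.Sum using (_⊎_)
open import Relation.Binary.PropositionalEquality using (_≡_)

∑ : (n : ℕ) → (Fin n → ℚ) → ℚ
∑ zero    f = 0ℚ
∑ (suc n) f = f zero + ∑ n (λ i → f (suc i))

Matrix : ℕ → Set
Matrix n = Fin n → Fin n → ℚ

WinLose : {n : ℕ} → Matrix n → Set
WinLose {n} A = ∀ (i j : Fin n) → (A i j ≡ 0ℚ) ⊎ (A i j ≡ 1ℚ)

IsMixed : (n : ℕ) → (Fin n → ℚ) → Set
IsMixed n x = (∀ i → 0ℚ ≤ x i) × (∑ n x ≡ 1ℚ)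

U : {n : ℕ} → Matrix n → (Fin n → ℚ) → (Fin n → ℚ) → ℚ
U {n} A x y = ∑ n (λ i → ∑ n (λ j → x i * (A i j * y j)))

IsNash : {n : ℕ} → Matrix n → Matrix n → (Fin n → ℚ) → (Fin n → ℚ) → Set
IsNash {n} R C x y =
  IsMixed n x × IsMixed n y ×
  (∀ x' → IsMixed n x' → U R x' y ≤ U R x y) ×
  (∀ y' → IsMixed n y' → U C x y' ≤ U C x y)

IsPureNash : {n : ℕ} → Matrix n → Matrix n → Fin n → Fin n → Set
IsPureNash {n} R C a b =
  (∀ a' → R a' b ≤ R a b) × (∀ b' → C a b' ≤ C a b)

-- If the row player earns 0 at (x, y), then every column in the support of y is an
-- all-zero column of R, since every pure deviation earns at least 0. If the column
-- player wins against some row i in such a column j, then (i, j) is pure: the row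
-- player is indifferent within a zero column. Otherwise C vanishes on the support of
-- y, so the column player earns 0 too, every row in the support of x is an all-zero
-- row of C, and any pair from the two supports is pure. The case where the column
-- player earns 0 is the row case for the transposed game.
module Submission where

open import Defs
open import Data.Nat using (ℕ; zero; suc)
open import Data.Fin using (Fin; zero; suc)
open import Data.Rational using (ℚ; 0ℚ; 1ℚ; _+_; _*_; _≤_; 1/_; ≢-nonZero; nonNegative)
open import Data.Rational.Properties
open import Data.Product using (Σ; _,_; proj₁; proj₂; swap)
open import Data.Sum using (_⊎_; inj₁; inj₂)
open import Data.Empty using (⊥-elim)
open import Relation.Nullary using (yes; no; ¬?)
open import Relation.Nullary.Decidable using (_×-dec_)
open import Relation.Binary.PropositionalEquality
  using (_≡_; _≢_; refl; sym; trans; cong; cong₂; subst; subst₂; module ≡-Reasoning)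
open import Algebra.Bundles using (CommutativeMonoid)
import Algebra.Properties.CommutativeSemigroup as CommutativeSemigroupProperties
import Data.Fin.Properties as Fin

open CommutativeSemigroupProperties
  (CommutativeMonoid.commutativeSemigroup +-0-commutativeMonoid)
  using () renaming (interchange to +-interchange)
open CommutativeSemigroupProperties
  (CommutativeMonoid.commutativeSemigroup *-1-commutativeMonoid)
  using () renaming (x∙yz≈z∙yx to x*yz≡z*yx)

p*q≡0⇒q≢0⇒p≡0 : ∀ {p q} → p * q ≡ 0ℚ → q ≢ 0ℚ → p ≡ 0ℚ
p*q≡0⇒q≢0⇒p≡0 {p} {q} pq≡0 q≢0 = begin
  p                ≡⟨ sym (*-identityʳ p) ⟩
  p * 1ℚ           ≡⟨ cong (p *_) (sym (*-inverseʳ q)) ⟩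
  p * (q * 1/ q)   ≡⟨ sym (*-assoc p q (1/ q)) ⟩
  (p * q) * 1/ q   ≡⟨ cong (_* 1/ q) pq≡0 ⟩
  0ℚ * 1/ q        ≡⟨ *-zeroˡ (1/ q) ⟩
  0ℚ               ∎
  where
  open ≡-Reasoning
  instance
    q-nonZero = ≢-nonZero q≢0

*-nonNeg : ∀ {p q} → 0ℚ ≤ p → 0ℚ ≤ q → 0ℚ ≤ p * q
*-nonNeg {p} {q} 0≤p 0≤q =
  nonNegative⁻¹ (p * q) {{nonNeg*nonNeg⇒nonNeg p {{nonNegative 0≤p}} q {{nonNegative 0≤q}}}}

∑-cong : ∀ n {f g : Fin n → ℚ} → (∀ i → f i ≡ g i) → ∑ n f ≡ ∑ n g
∑-cong zero    f≡g = refl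
∑-cong (suc n) f≡g = cong₂ _+_ (f≡g zero) (∑-cong n (λ i → f≡g (suc i)))

∑-0 : ∀ n → ∑ n (λ _ → 0ℚ) ≡ 0ℚ
∑-0 zero    = refl
∑-0 (suc n) = trans (cong (0ℚ +_) (∑-0 n)) (+-identityˡ 0ℚ)

∑-≡0 : ∀ n {f : Fin n → ℚ} → (∀ i → f i ≡ 0ℚ) → ∑ n f ≡ 0ℚ
∑-≡0 n f≡0 = trans (∑-cong n f≡0) (∑-0 n)

∑-+ : ∀ n (f g : Fin n → ℚ) → ∑ n (λ i → f i + g i) ≡ ∑ n f + ∑ n g
∑-+ zero    f g = refl
∑-+ (suc n) f g = trans (cong (f zero + g zero +_) (∑-+ n _ _))
                        (+-interchange (f zero) (g zero) _ _)

∑-comm : ∀ m n (f : Fin m → Fin n → ℚ) →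
         ∑ m (λ i → ∑ n (f i)) ≡ ∑ n (λ j → ∑ m (λ i → f i j))
∑-comm zero    n f = sym (∑-0 n)
∑-comm (suc m) n f = trans (cong (∑ n (f zero) +_) (∑-comm m n (λ i → f (suc i))))
                           (sym (∑-+ n (f zero) _))

*-distribˡ-∑ : ∀ n (c : ℚ) (f : Fin n → ℚ) → ∑ n (λ i → c * f i) ≡ c * ∑ n f
*-distribˡ-∑ zero    c f = sym (*-zeroʳ c)
*-distribˡ-∑ (suc n) c f = trans (cong (c * f zero +_) (*-distribˡ-∑ n c _))
                                 (sym (*-distribˡ-+ c (f zero) _))

∑-nonNeg : ∀ n {f : Fin n → ℚ} → (∀ i → 0ℚ ≤ f i) → 0ℚ ≤ ∑ n f
∑-nonNeg zero    f≥0 = ≤-refl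
∑-nonNeg (suc n) f≥0 =
  +-mono-≤ (f≥0 zero) (∑-nonNeg n (λ i → f≥0 (suc i)))

≤-∑ : ∀ n {f : Fin n → ℚ} → (∀ i → 0ℚ ≤ f i) → ∀ i → f i ≤ ∑ n f
≤-∑ (suc n) {f} f≥0 zero =
  subst (_≤ ∑ (suc n) f) (+-identityʳ (f zero))
        (+-monoʳ-≤ (f zero) (∑-nonNeg n (λ i → f≥0 (suc i))))
≤-∑ (suc n) {f} f≥0 (suc i) =
  subst (_≤ ∑ (suc n) f) (+-identityˡ (f (suc i)))
        (+-mono-≤ (f≥0 zero) (≤-∑ n (λ i → f≥0 (suc i)) i))

∑≢0⇒∃≢0 : ∀ n (f : Fin n → ℚ) → ∑ n f ≢ 0ℚ → Σ (Fin n) (λ i → f i ≢ 0ℚ)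
∑≢0⇒∃≢0 zero    f ∑≢0 = ⊥-elim (∑≢0 refl)
∑≢0⇒∃≢0 (suc n) f ∑≢0 with f zero ≟ 0ℚ
... | no  f₀≢0 = zero , f₀≢0
... | yes f₀≡0 = let i , fᵢ≢0 = ∑≢0⇒∃≢0 n (λ i → f (suc i)) tail≢0 in suc i , fᵢ≢0
  where
  tail≢0 : ∑ n (λ i → f (suc i)) ≢ 0ℚ
  tail≢0 ∑≡0 = ∑≢0 (trans (cong₂ _+_ f₀≡0 ∑≡0) (+-identityˡ 0ℚ))

support : ∀ {n} {x : Fin n → ℚ} → IsMixed n x → Σ (Fin n) (λ i → x i ≢ 0ℚ)
support {n} {x} (_ , ∑≡1) = ∑≢0⇒∃≢0 n x (λ ∑≡0 → 1≢0 (trans (sym ∑≡1) ∑≡0))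

pure : ∀ {n} → Fin n → Fin n → ℚ
pure zero    zero    = 1ℚ
pure zero    (suc _) = 0ℚ
pure (suc _) zero    = 0ℚ
pure (suc a) (suc i) = pure a i

∑-pure : ∀ n (a : Fin n) (f : Fin n → ℚ) → ∑ n (λ i → pure a i * f i) ≡ f a
∑-pure (suc n) zero f = begin
  1ℚ * f zero + ∑ n (λ i → 0ℚ * f (suc i))  ≡⟨ cong₂ _+_ (*-identityˡ (f zero))
                                                  (∑-≡0 n (λ i → *-zeroˡ (f (suc i)))) ⟩
  f zero + 0ℚ                               ≡⟨ +-identityʳ (f zero) ⟩
  f zero                                    ∎
  where open ≡-Reasoning
∑-pure (suc n) (suc a) f =
  trans (cong₂ _+_ (*-zeroˡ (f zero)) (∑-pure n a (λ i → f (suc i))))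
        (+-identityˡ (f (suc a)))

pure-isMixed : ∀ {n} (a : Fin n) → IsMixed n (pure a)
pure-isMixed {n} a = pure-nonNeg a , trans (∑-cong n (λ i → sym (*-identityʳ (pure a i))))
                                           (∑-pure n a (λ _ → 1ℚ))
  where
  pure-nonNeg : ∀ {n} (a i : Fin n) → 0ℚ ≤ pure a i
  pure-nonNeg zero    zero    = nonNegative⁻¹ 1ℚ
  pure-nonNeg zero    (suc i) = ≤-refl
  pure-nonNeg (suc a) zero    = ≤-refl
  pure-nonNeg (suc a) (suc i) = pure-nonNeg a i

transpose : ∀ {n} → Matrix n → Matrix n
transpose A i j = A j i

U-pure : ∀ {n} (A : Matrix n) (a : Fin n) y → U A (pure a) y ≡ ∑ n (λ j → A a j * y j)
U-pure {n} A a y = trans (∑-cong n (λ i → *-distribˡ-∑ n (pure a i) (λ j → A i j * y j)))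
                         (∑-pure n a (λ i → ∑ n (λ j → A i j * y j)))

U-transpose : ∀ {n} (A : Matrix n) x y → U (transpose A) y x ≡ U A x y
U-transpose {n} A x y = sym (trans (∑-comm n n (λ i j → x i * (A i j * y j)))
  (∑-cong n (λ j → ∑-cong n (λ i → x*yz≡z*yx (x i) (A i j) (y j)))))

U-≡0 : ∀ {n} (A : Matrix n) x y → (∀ i j → A i j * y j ≡ 0ℚ) → U A x y ≡ 0ℚ
U-≡0 {n} A x y Ay≡0 =
  ∑-≡0 n (λ i → ∑-≡0 n (λ j → trans (cong (x i *_) (Ay≡0 i j)) (*-zeroʳ (x i))))

IsNash-transpose : ∀ {n} {R C : Matrix n} {x y} →
                   IsNash R C x y → IsNash (transpose C) (transpose R) y x
IsNash-transpose {R = R} {C} {x} {y} (x-mixed , y-mixed , R-best , C-best) =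
  y-mixed , x-mixed ,
  (λ y′ y′-mixed → subst₂ _≤_ (sym (U-transpose C x y′)) (sym (U-transpose C x y))
                              (C-best y′ y′-mixed)) ,
  (λ x′ x′-mixed → subst₂ _≤_ (sym (U-transpose R x′ y)) (sym (U-transpose R x y))
                              (R-best x′ x′-mixed))

WinLose-transpose : ∀ {n} {A : Matrix n} → WinLose A → WinLose (transpose A)
WinLose-transpose A-winLose i j = A-winLose j i

WinLose⇒nonNeg : ∀ {n} {A : Matrix n} → WinLose A → ∀ i j → 0ℚ ≤ A i j
WinLose⇒nonNeg A-winLose i j with A-winLose i j
... | inj₁ Aᵢⱼ≡0 = ≤-reflexive (sym Aᵢⱼ≡0)
... | inj₂ Aᵢⱼ≡1 = subst (0ℚ ≤_) (sym Aᵢⱼ≡1) (nonNegative⁻¹ 1ℚ)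

WinLose⇒≤1 : ∀ {n} {A : Matrix n} → WinLose A → ∀ i j → A i j ≤ 1ℚ
WinLose⇒≤1 A-winLose i j with A-winLose i j
... | inj₁ Aᵢⱼ≡0 = subst (_≤ 1ℚ) (sym Aᵢⱼ≡0) (nonNegative⁻¹ 1ℚ)
... | inj₂ Aᵢⱼ≡1 = ≤-reflexive Aᵢⱼ≡1

WinLose-≢1⇒≡0 : ∀ {n} {A : Matrix n} → WinLose A → ∀ i j → A i j ≢ 1ℚ → A i j ≡ 0ℚ
WinLose-≢1⇒≡0 A-winLose i j Aᵢⱼ≢1 with A-winLose i j
... | inj₁ Aᵢⱼ≡0 = Aᵢⱼ≡0
... | inj₂ Aᵢⱼ≡1 = ⊥-elim (Aᵢⱼ≢1 Aᵢⱼ≡1)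

payoff≡0⇒supportColumn≡0 : ∀ {n} {A : Matrix n} {x y} →
  (∀ i j → 0ℚ ≤ A i j) → (∀ j → 0ℚ ≤ y j) →
  (∀ x′ → IsMixed n x′ → U A x′ y ≤ U A x y) → U A x y ≡ 0ℚ →
  ∀ a j → y j ≢ 0ℚ → A a j ≡ 0ℚ
payoff≡0⇒supportColumn≡0 {n} {A} {x} {y} A≥0 y≥0 best U≡0 a j yⱼ≢0 =
  p*q≡0⇒q≢0⇒p≡0 (≤-antisym Aₐⱼyⱼ≤0 (term≥0 j)) yⱼ≢0
  where
  term≥0 : ∀ j → 0ℚ ≤ A a j * y j
  term≥0 j = *-nonNeg (A≥0 a j) (y≥0 j)
  Aₐⱼyⱼ≤0 : A a j * y j ≤ 0ℚ
  Aₐⱼyⱼ≤0 = begin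
    A a j * y j                ≤⟨ ≤-∑ n term≥0 j ⟩
    ∑ n (λ j → A a j * y j)    ≡⟨ sym (U-pure A a y) ⟩
    U A (pure a) y             ≤⟨ best (pure a) (pure-isMixed a) ⟩
    U A x y                    ≡⟨ U≡0 ⟩
    0ℚ                         ∎
    where open ≤-Reasoning

zeroColumn⇒IsPureNash : ∀ {n} {R C : Matrix n} {a b} →
  (∀ a′ → R a′ b ≡ 0ℚ) → (∀ b′ → C a b′ ≤ C a b) → IsPureNash R C a b
zeroColumn⇒IsPureNash {a = a} R-column≡0 C-best =
  (λ a′ → ≤-reflexive (trans (R-column≡0 a′) (sym (R-column≡0 a)))) , C-best

payoffs≡0⇒pureNash : ∀ {n} {R C : Matrix n} {x y} →
  (∀ i j → 0ℚ ≤ R i j) → (∀ i j → 0ℚ ≤ C i j) → IsNash R C x y →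
  U R x y ≡ 0ℚ → U C x y ≡ 0ℚ → Σ (Fin n) (λ a → Σ (Fin n) (λ b → IsPureNash R C a b))
payoffs≡0⇒pureNash {n} {R} {C} {x} {y} R≥0 C≥0
                   nash@(x-mixed , y-mixed , R-best , _) UR≡0 UC≡0 =
  a , b , zeroColumn⇒IsPureNash {R = R} {C} R-column≡0
            (λ b′ → ≤-reflexive (trans (C-row≡0 b′) (sym (C-row≡0 b))))
  where
  Cᵀ-best : ∀ y′ → IsMixed n y′ → U (transpose C) y′ x ≤ U (transpose C) y x
  Cᵀ-best = proj₁ (proj₂ (proj₂ (IsNash-transpose {R = R} {C} nash)))
  a b : Fin n
  a = proj₁ (support x-mixed)
  b = proj₁ (support y-mixed)
  R-column≡0 : ∀ a′ → R a′ b ≡ 0ℚ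
  R-column≡0 a′ = payoff≡0⇒supportColumn≡0 {A = R} {x} {y} R≥0 (proj₁ y-mixed) R-best UR≡0
                    a′ b (proj₂ (support y-mixed))
  C-row≡0 : ∀ b′ → C a b′ ≡ 0ℚ
  C-row≡0 b′ = payoff≡0⇒supportColumn≡0 {A = transpose C} {y} {x}
                 (λ i j → C≥0 j i) (proj₁ x-mixed) Cᵀ-best (trans (U-transpose C x y) UC≡0)
                 b′ a (proj₂ (support x-mixed))

rowPayoff≡0⇒pureNash : ∀ {n} {R C : Matrix n} {x y} →
  WinLose R → WinLose C → IsNash R C x y → U R x y ≡ 0ℚ →
  Σ (Fin n) (λ a → Σ (Fin n) (λ b → IsPureNash R C a b))
rowPayoff≡0⇒pureNash {n} {R} {C} {x} {y} R-winLose C-winLose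
                     nash@(_ , y-mixed , R-best , _) UR≡0
  with Fin.any? (λ i → Fin.any? (λ j → ¬? (y j ≟ 0ℚ) ×-dec (C i j ≟ 1ℚ)))
... | yes (i , j , yⱼ≢0 , Cᵢⱼ≡1) =
  i , j , zeroColumn⇒IsPureNash {R = R} {C}
            (λ a → payoff≡0⇒supportColumn≡0 {A = R} {x} {y} (WinLose⇒nonNeg R-winLose)
                     (proj₁ y-mixed) R-best UR≡0 a j yⱼ≢0)
            (λ b → subst (C i b ≤_) (sym Cᵢⱼ≡1) (WinLose⇒≤1 C-winLose i b))
... | no ∄i,j = payoffs≡0⇒pureNash (WinLose⇒nonNeg R-winLose) (WinLose⇒nonNeg C-winLose)
                  nash UR≡0 (U-≡0 C x y Cy≡0)
  where
  Cy≡0 : ∀ i j → C i j * y j ≡ 0ℚ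
  Cy≡0 i j with y j ≟ 0ℚ
  ... | yes yⱼ≡0 = trans (cong (C i j *_) yⱼ≡0) (*-zeroʳ (C i j))
  ... | no  yⱼ≢0 = trans (cong (_* y j) Cᵢⱼ≡0) (*-zeroˡ (y j))
    where
    Cᵢⱼ≡0 : C i j ≡ 0ℚ
    Cᵢⱼ≡0 = WinLose-≢1⇒≡0 C-winLose i j (λ Cᵢⱼ≡1 → ∄i,j (i , j , yⱼ≢0 , Cᵢⱼ≡1))

mainTheorem16 : (n : ℕ) (R C : Matrix n) → WinLose R → WinLose C →
    (x y : Fin n → ℚ) → IsNash R C x y →
    (U R x y ≡ 0ℚ) ⊎ (U C x y ≡ 0ℚ) →
    Σ (Fin n) (λ a → Σ (Fin n) (λ b → IsPureNash R C a b))
mainTheorem16 n R C R-winLose C-winLose x y nash (inj₁ UR≡0) =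
  rowPayoff≡0⇒pureNash R-winLose C-winLose nash UR≡0
mainTheorem16 n R C R-winLose C-winLose x y nash (inj₂ UC≡0) =
  let b , a , pureNashᵀ = rowPayoff≡0⇒pureNash {R = transpose C} {transpose R}
                            (WinLose-transpose C-winLose) (WinLose-transpose R-winLose)
                            (IsNash-transpose {R = R} {C} nash) (trans (U-transpose C x y) UC≡0)
  in a , b , swap pureNashᵀ
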